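{- Every language definable by an $\mathrm{LTL}^+$ formula is definable by a closed $\mathrm{FO}^{3+}$ formula.
   Context: Let $\Sigma$ be a finite set of unary predicate symbols and let the alphabet be $A=2^{\Sigma}$. A word is $u=u_0\cdots u_{m-1}$ with $u_i\in A$. $\mathrm{FO}$ formulas have grammar $\varphi,\psi ::= \bot\mid\top\mid \beta(x,y)\mid a(x)\mid \varphi\wedge\psi\mid\varphi\vee\psi\mid\exists x,\varphi\mid\forall x,\varphi\mid\neg\varphi$ with $a\in\Sigma$ and $\beta\in\{<,\le,=,\neq,\mathrm{succ},\mathrm{nsucc}\}$ interpreted on positions ($\mathrm{succ}(x,y)$ iff $y=x+1$, $\mathrm{nsucc}(x,y)$ iff $y\ne x+1$); $a(x)$ holds iff $a$ belongs to the letter at position $x$. $\mathrm{FO}^{3+}$ consists of $\neg$-free formulas using only three distinct variable names (reusable); a closed formula defines $\{u:u\models\varphi\}$. $\mathrm{LTL}^+$ has grammar $\varphi,\psi::=\bot\mid\top\mid a\mid\varphi\wedge\psi\mid\varphi\vee\psi\mid\mathrm{X}\varphi\mid\varphi\,\mathrm{U}\,\psi\mid\varphi\,\mathrm{R}\,\psi$, evaluated at position $i$: $u,i\models a$ iff $a\in u_i$; $u,i\models\mathrm{X}\varphi$ iff $i+1<m$ and $u,i+1\models\varphi$; $u,i\models\varphi\,\mathrm{U}\,\psi$ iff some $j\ge i$ has $u,j\models\psi$ and $u,k\models\varphi$ for all $i\le k<j$; $u,i\models\varphi\,\mathrm{R}\,\psi$ iff $u,i\models\psi\,\mathrm{U}\,(\psi\wedge\varphi)$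 or $u,k\models\psi$ for all $k\ge i$. An $\mathrm{LTL}^+$ formula defines $\{u: u,0\models\varphi\}$. -}

module Defs where

open import Data.Nat using (ℕ; _<_; _≤_)
open import Data.Fin using (Fin)
open import Data.Bool using (Bool; true)
open import Data.List using (List; length)
open import Data.Maybe using (Maybe; just; nothing)
open import Data.Product using (Σ; _×_; ∃)
open import Data.Sum using (_⊎_)
open import Data.Unit using (⊤)
open import Data.Empty using (⊥)
open import Relation.Nullary using (¬_)
open import Relation.Binary.PropositionalEquality using (_≡_; _≢_)

-- Σ = Fin n (a finite set of unary predicate symbols); A = 2^Σ = Fin n → Bool.
Letter : ℕ → Set
Letter n = Fin n → Bool

Word : ℕ → Set
Word n = List (Letter n)

letterAt : ∀ {n} → Word n → ℕ → Maybe (Letter n)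
letterAt List.[] _ = nothing
letterAt (a List.∷ u) 0 = just a
letterAt (a List.∷ u) (ℕ.suc i) = letterAt u i

Has : ∀ {n} → Word n → ℕ → Fin n → Set
Has u i a = Σ _ λ l → letterAt u i ≡ just l × l a ≡ true

data Rel : Set where
  lt le eq neq succ nsucc : Rel

⟦_⟧R : Rel → ℕ → ℕ → Set
⟦ lt ⟧R i j = i < j
⟦ le ⟧R i j = i ≤ j
⟦ eq ⟧R i j = i ≡ j
⟦ neq ⟧R i j = i ≢ j
⟦ succ ⟧R i j = j ≡ ℕ.suc i
⟦ nsucc ⟧R i j = j ≢ ℕ.suc i

Var : Set
Var = ℕ

data FO (n : ℕ) : Set where
  ff tt : FO n
  rel   : Rel → Var → Var → FO n
  pred  : Fin n → Var → FO n
  _∧_ _∨_ : FO n → FO n → FO n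
  ex all : Var → FO n → FO n
  neg   : FO n → FO n

Assign : Set
Assign = Var → ℕ

_[_↦_] : Assign → Var → ℕ → Assign
(ρ [ x ↦ i ]) y with Data.Nat._≟_ x y
... | Relation.Nullary.yes _ = i
... | Relation.Nullary.no _ = ρ y

Sat : ∀ {n} → Word n → Assign → FO n → Set
Sat u ρ ff = ⊥
Sat u ρ tt = ⊤
Sat u ρ (rel β x y) = ⟦ β ⟧R (ρ x) (ρ y)
Sat u ρ (pred a x) = Has u (ρ x) a
Sat u ρ (φ ∧ ψ) = Sat u ρ φ × Sat u ρ ψ
Sat u ρ (φ ∨ ψ) = Sat u ρ φ ⊎ Sat u ρ ψ
Sat u ρ (ex x φ) = Σ ℕ λ i → i < length u × Sat u (ρ [ x ↦ i ]) φ
Sat u ρ (all x φ) = (i : ℕ) → i < length u → Sat u (ρ [ x ↦ i ]) φ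
Sat u ρ (neg φ) = ¬ Sat u ρ φ

FreeIn : ∀ {n} → Var → FO n → Set
FreeIn z ff = ⊥
FreeIn z tt = ⊥
FreeIn z (rel β x y) = z ≡ x ⊎ z ≡ y
FreeIn z (pred a x) = z ≡ x
FreeIn z (φ ∧ ψ) = FreeIn z φ ⊎ FreeIn z ψ
FreeIn z (φ ∨ ψ) = FreeIn z φ ⊎ FreeIn z ψ
FreeIn z (ex x φ) = z ≢ x × FreeIn z φ
FreeIn z (all x φ) = z ≢ x × FreeIn z φ
FreeIn z (neg φ) = FreeIn z φ

Closed : ∀ {n} → FO n → Set
Closed φ = ∀ z → ¬ FreeIn z φ

AllVars : ∀ {n} → (Var → Set) → FO n → Set
AllVars P ff = ⊤
AllVars P tt = ⊤
AllVars P (rel β x y) = P x × P y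
AllVars P (pred a x) = P x
AllVars P (φ ∧ ψ) = AllVars P φ × AllVars P ψ
AllVars P (φ ∨ ψ) = AllVars P φ × AllVars P ψ
AllVars P (ex x φ) = P x × AllVars P φ
AllVars P (all x φ) = P x × AllVars P φ
AllVars P (neg φ) = AllVars P φ

NegFree : ∀ {n} → FO n → Set
NegFree ff = ⊤
NegFree tt = ⊤
NegFree (rel β x y) = ⊤
NegFree (pred a x) = ⊤
NegFree (φ ∧ ψ) = NegFree φ × NegFree ψ
NegFree (φ ∨ ψ) = NegFree φ × NegFree ψ
NegFree (ex x φ) = NegFree φ
NegFree (all x φ) = NegFree φ
NegFree (neg φ) = ⊥

FO3+ : ∀ {n} → FO n → Set
FO3+ φ = NegFree φ × Σ Var λ x → Σ Var λ y → Σ Var λ z →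
           AllVars (λ v → v ≡ x ⊎ v ≡ y ⊎ v ≡ z) φ

-- language of a closed formula (the initial assignment is irrelevant for closed φ)
_⊨FO_ : ∀ {n} → Word n → FO n → Set
u ⊨FO φ = Sat u (λ _ → 0) φ

data LTL+ (n : ℕ) : Set where
  ff tt : LTL+ n
  atom  : Fin n → LTL+ n
  _∧_ _∨_ : LTL+ n → LTL+ n → LTL+ n
  X     : LTL+ n → LTL+ n
  _U_ _R_ : LTL+ n → LTL+ n → LTL+ n

SatL : ∀ {n} → Word n → ℕ → LTL+ n → Set
SatL u i ff = ⊥
SatL u i tt = ⊤
SatL u i (atom a) = Has u i a
SatL u i (φ ∧ ψ) = SatL u i φ × SatL u i ψ
SatL u i (φ ∨ ψ) = SatL u i φ ⊎ SatL u i ψ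
SatL u i (X φ) = ℕ.suc i < length u × SatL u (ℕ.suc i) φ
SatL u i (φ U ψ) = Σ ℕ λ j → i ≤ j × j < length u × SatL u j ψ ×
                     ((k : ℕ) → i ≤ k → k < j → SatL u k φ)
-- φ R ψ  :=  ψ U (ψ ∧ φ)  or  ψ holds at all k ≥ i  (first disjunct unfolded)
SatL u i (φ R ψ) = (Σ ℕ λ j → i ≤ j × j < length u × (SatL u j ψ × SatL u j φ) ×
                     ((k : ℕ) → i ≤ k → k < j → SatL u k ψ))
                   ⊎ ((k : ℕ) → i ≤ k → k < length u → SatL u k ψ)

_⊨L_ : ∀ {n} → Word n → LTL+ n → Set
u ⊨L φ = SatL u 0 φ

{-# OPTIONS --safe #-}
-- The standard translation of LTL⁺ into first-order logic, with three variable names.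
-- An LTL⁺ formula becomes a formula F x y z whose only free variable x stands for the
-- current position; y and z are scratch names. A translated subformula depends only on
-- its own position, so X, U and R bind a scratch name and place the subformula at a
-- permutation of (x, y, z) that puts the bound name first, leaving the other two free
-- for reuse; all three are needed at once only in the guard x ≤ z < y of U. Negation
-- never arises because LTL⁺ has both U and its dual R. The closed formula states the
-- translation at the first position; the empty word has no positions, so there the
-- truth value of the LTL⁺ formula is computed directly and added as a constant.
module Submission where

open import Defs
open import Data.Bool using (Bool; true; false; T) renaming (_∧_ to _∧ᵇ_; _∨_ to _∨ᵇ_)
open import Data.Bool.Properties using (T-∧; T-∨)
open import Data.Nat using (ℕ; suc; _<_; _≤_; _≟_; _<?_; _≤?_; z≤n; z<s)
open import Data.Nat.Properties using (<⇒≤; <⇒≱; <-≤-trans; ≮⇒≥; ≰⇒>; n≤0⇒n≡0)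
open import Data.Product using (Σ; _×_; _,_)
open import Data.Product.Function.NonDependent.Propositional using (_×-⇔_)
open import Data.Product.Function.Dependent.Propositional using (Σ-⇔)
open import Data.Sum using (_⊎_; inj₁; inj₂; fromInj₂)
open import Data.Sum.Function.Propositional using (_⊎-⇔_)
open import Data.Unit using (tt)
open import Data.Empty using (⊥-elim)
open import Data.List using ([]; _∷_; length)
open import Relation.Nullary using (yes; no)
open import Relation.Binary.PropositionalEquality using (_≡_; _≢_; refl; ≢-sym)
open import Function.Bundles using (_⇔_; mk⇔; module Equivalence)
open import Function.Construct.Identity using (↠-id)
open import Function.Properties.Equivalence using ()
  renaming (refl to ⇔-refl; sym to ⇔-sym; trans to ⇔-trans)

open Equivalence using (to; from)

∀<-⇔ : {A B : ℕ → Set} {l : ℕ} →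
       (∀ k → A k ⇔ B k) → (∀ k → k < l → A k) ⇔ (∀ k → k < l → B k)
∀<-⇔ A⇔B = mk⇔ (λ f k k<l → to (A⇔B k) (f k k<l)) (λ g k k<l → from (A⇔B k) (g k k<l))

∃<-⇔ : {A B : ℕ → Set} {l : ℕ} →
       (∀ k → A k ⇔ B k) → (Σ ℕ λ k → k < l × A k) ⇔ (Σ ℕ λ k → k < l × B k)
∃<-⇔ A⇔B = Σ-⇔ (↠-id ℕ) (λ {k} → ⇔-refl ×-⇔ A⇔B k)

∃<-one-point : {P : ℕ → Set} {l m : ℕ} →
               (Σ ℕ λ j → j < l × (j ≡ m × P j)) ⇔ (m < l × P m)
∃<-one-point = mk⇔ (λ { (_ , j<l , refl , p) → j<l , p }) (λ (m<l , p) → _ , m<l , refl , p)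

module _ {P : ℕ → Set} {i l : ℕ} where

  lower-guard⇔ : (∀ k → k < l → k < i ⊎ P k) ⇔ (∀ k → i ≤ k → k < l → P k)
  lower-guard⇔ = mk⇔ forward backward
    where
    forward : (∀ k → k < l → k < i ⊎ P k) → ∀ k → i ≤ k → k < l → P k
    forward g k i≤k k<l = fromInj₂ (λ k<i → ⊥-elim (<⇒≱ k<i i≤k)) (g k k<l)

    backward : (∀ k → i ≤ k → k < l → P k) → ∀ k → k < l → k < i ⊎ P k
    backward h k k<l with k <? i
    ... | yes k<i = inj₁ k<i
    ... | no k≮i = inj₂ (h k (≮⇒≥ k≮i) k<l)

  upper-guard⇔ : ∀ {j} → j ≤ l →
    (∀ k → i ≤ k → k < l → j ≤ k ⊎ P k) ⇔ (∀ k → i ≤ k → k < j → P k)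
  upper-guard⇔ {j} j≤l = mk⇔ forward backward
    where
    forward : (∀ k → i ≤ k → k < l → j ≤ k ⊎ P k) → ∀ k → i ≤ k → k < j → P k
    forward g k i≤k k<j = fromInj₂ (λ j≤k → ⊥-elim (<⇒≱ k<j j≤k)) (g k i≤k (<-≤-trans k<j j≤l))

    backward : (∀ k → i ≤ k → k < j → P k) → ∀ k → i ≤ k → k < l → j ≤ k ⊎ P k
    backward h k i≤k _ with j ≤? k
    ... | yes j≤k = inj₁ j≤k
    ... | no j≰k = inj₂ (h k i≤k (≰⇒> j≰k))

↦-same : (ρ : Assign) (x : Var) (i : ℕ) → (ρ [ x ↦ i ]) x ≡ i
↦-same ρ x i with x ≟ x
... | yes _ = refl
... | no x≢x = ⊥-elim (x≢x refl)

↦-other : {ρ : Assign} {x y : Var} {i : ℕ} (j : ℕ) → x ≢ y → ρ y ≡ i → (ρ [ x ↦ j ]) y ≡ i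
↦-other {x = x} {y} j x≢y ρy≡i with x ≟ y
... | yes x≡y = ⊥-elim (x≢y x≡y)
... | no _ = ρy≡i

⟦_⟧R-cong : ∀ β {a a′ b b′} → a ≡ a′ → b ≡ b′ → ⟦ β ⟧R a b ⇔ ⟦ β ⟧R a′ b′
⟦ β ⟧R-cong refl refl = ⇔-refl

record Distinct (x y z : Var) : Set where
  constructor distinct
  field
    y≢x : y ≢ x
    z≢x : z ≢ x
    z≢y : z ≢ y

swap : ∀ {x y z} → Distinct x y z → Distinct y x z
swap (distinct y≢x z≢x z≢y) = distinct (≢-sym y≢x) z≢y z≢x

rotate : ∀ {x y z} → Distinct x y z → Distinct z x y
rotate (distinct y≢x z≢x z≢y) = distinct (≢-sym z≢x) (≢-sym z≢y) y≢x

Formula₃ : ℕ → Set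
Formula₃ n = Var → Var → Var → FO n

module _ {n : ℕ} where

  infixr 2 _∧₃_ _∨₃_

  _∧₃_ _∨₃_ : Formula₃ n → Formula₃ n → Formula₃ n
  (F ∧₃ G) x y z = F x y z ∧ G x y z
  (F ∨₃ G) x y z = F x y z ∨ G x y z

  next₃ : Formula₃ n → Formula₃ n
  next₃ F x y z = ex y (rel succ x y ∧ F y x z)

  until₃ : Formula₃ n → Formula₃ n → Formula₃ n
  until₃ F G x y z = ex y (rel le x y ∧ (G y x z ∧ all z (rel lt z x ∨ (rel le y z ∨ F z x y))))

  globally₃ : Formula₃ n → Formula₃ n
  globally₃ F x y z = all y (rel lt y x ∨ F y x z)

translate : ∀ {n} → LTL+ n → Formula₃ n
translate ff = λ _ _ _ → ff
translate tt = λ _ _ _ → tt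
translate (atom a) = λ x _ _ → pred a x
translate (φ ∧ ψ) = translate φ ∧₃ translate ψ
translate (φ ∨ ψ) = translate φ ∨₃ translate ψ
translate (X φ) = next₃ (translate φ)
translate (φ U ψ) = until₃ (translate φ) (translate ψ)
translate (φ R ψ) = until₃ (translate ψ) (translate ψ ∧₃ translate φ) ∨₃ globally₃ (translate ψ)

record IsFO3+Unary {n} (F : Formula₃ n) : Set₁ where
  field
    negFree : ∀ x y z → NegFree (F x y z)
    allVars : (V : Var → Set) {x y z : Var} → V x → V y → V z → AllVars V (F x y z)
    freeOnlyFirst : ∀ {x y z w} → FreeIn w (F x y z) → w ≡ x

open IsFO3+Unary

module _ {n : ℕ} {F G : Formula₃ n} (F-fo3+ : IsFO3+Unary F) (G-fo3+ : IsFO3+Unary G) where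

  fo3+-∧₃ : IsFO3+Unary (F ∧₃ G)
  fo3+-∧₃ = record
    { negFree = λ x y z → negFree F-fo3+ x y z , negFree G-fo3+ x y z
    ; allVars = λ V vx vy vz → allVars F-fo3+ V vx vy vz , allVars G-fo3+ V vx vy vz
    ; freeOnlyFirst = λ { (inj₁ p) → freeOnlyFirst F-fo3+ p ; (inj₂ p) → freeOnlyFirst G-fo3+ p }
    }

  fo3+-∨₃ : IsFO3+Unary (F ∨₃ G)
  fo3+-∨₃ = record
    { negFree = λ x y z → negFree F-fo3+ x y z , negFree G-fo3+ x y z
    ; allVars = λ V vx vy vz → allVars F-fo3+ V vx vy vz , allVars G-fo3+ V vx vy vz
    ; freeOnlyFirst = λ { (inj₁ p) → freeOnlyFirst F-fo3+ p ; (inj₂ p) → freeOnlyFirst G-fo3+ p }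
    }

  fo3+-until₃ : IsFO3+Unary (until₃ F G)
  fo3+-until₃ = record
    { negFree = λ x y z → tt , negFree G-fo3+ y x z , tt , tt , negFree F-fo3+ z x y
    ; allVars = λ V vx vy vz →
        vy , (vx , vy) , allVars G-fo3+ V vy vx vz ,
        vz , (vz , vx) , (vy , vz) , allVars F-fo3+ V vz vx vy
    ; freeOnlyFirst = free
    }
    where
    free : ∀ {x y z w} → FreeIn w (until₃ F G x y z) → w ≡ x
    free (_ , inj₁ (inj₁ w≡x)) = w≡x
    free (w≢y , inj₁ (inj₂ w≡y)) = ⊥-elim (w≢y w≡y)
    free (w≢y , inj₂ (inj₁ p)) = ⊥-elim (w≢y (freeOnlyFirst G-fo3+ p))
    free (_ , inj₂ (inj₂ (w≢z , inj₁ (inj₁ w≡z)))) = ⊥-elim (w≢z w≡z)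
    free (_ , inj₂ (inj₂ (_ , inj₁ (inj₂ w≡x)))) = w≡x
    free (w≢y , inj₂ (inj₂ (_ , inj₂ (inj₁ (inj₁ w≡y))))) = ⊥-elim (w≢y w≡y)
    free (_ , inj₂ (inj₂ (w≢z , inj₂ (inj₁ (inj₂ w≡z))))) = ⊥-elim (w≢z w≡z)
    free (_ , inj₂ (inj₂ (w≢z , inj₂ (inj₂ p)))) = ⊥-elim (w≢z (freeOnlyFirst F-fo3+ p))

module _ {n : ℕ} {F : Formula₃ n} (F-fo3+ : IsFO3+Unary F) where

  fo3+-next₃ : IsFO3+Unary (next₃ F)
  fo3+-next₃ = record
    { negFree = λ x y z → tt , negFree F-fo3+ y x z
    ; allVars = λ V vx vy vz → vy , (vx , vy) , allVars F-fo3+ V vy vx vz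
    ; freeOnlyFirst = free
    }
    where
    free : ∀ {x y z w} → FreeIn w (next₃ F x y z) → w ≡ x
    free (_ , inj₁ (inj₁ w≡x)) = w≡x
    free (w≢y , inj₁ (inj₂ w≡y)) = ⊥-elim (w≢y w≡y)
    free (w≢y , inj₂ p) = ⊥-elim (w≢y (freeOnlyFirst F-fo3+ p))

  fo3+-globally₃ : IsFO3+Unary (globally₃ F)
  fo3+-globally₃ = record
    { negFree = λ x y z → tt , negFree F-fo3+ y x z
    ; allVars = λ V vx vy vz → vy , (vy , vx) , allVars F-fo3+ V vy vx vz
    ; freeOnlyFirst = free
    }
    where
    free : ∀ {x y z w} → FreeIn w (globally₃ F x y z) → w ≡ x
    free (w≢y , inj₁ (inj₁ w≡y)) = ⊥-elim (w≢y w≡y)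
    free (_ , inj₁ (inj₂ w≡x)) = w≡x
    free (w≢y , inj₂ p) = ⊥-elim (w≢y (freeOnlyFirst F-fo3+ p))

fo3+-translate : ∀ {n} (φ : LTL+ n) → IsFO3+Unary (translate φ)
fo3+-translate ff = record { negFree = λ _ _ _ → tt ; allVars = λ _ _ _ _ → tt ; freeOnlyFirst = λ () }
fo3+-translate tt = record { negFree = λ _ _ _ → tt ; allVars = λ _ _ _ _ → tt ; freeOnlyFirst = λ () }
fo3+-translate (atom a) = record { negFree = λ _ _ _ → tt ; allVars = λ _ vx _ _ → vx ; freeOnlyFirst = λ w≡x → w≡x }
fo3+-translate (φ ∧ ψ) = fo3+-∧₃ (fo3+-translate φ) (fo3+-translate ψ)
fo3+-translate (φ ∨ ψ) = fo3+-∨₃ (fo3+-translate φ) (fo3+-translate ψ)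
fo3+-translate (X φ) = fo3+-next₃ (fo3+-translate φ)
fo3+-translate (φ U ψ) = fo3+-until₃ (fo3+-translate φ) (fo3+-translate ψ)
fo3+-translate (φ R ψ) =
  fo3+-∨₃ (fo3+-until₃ ψ-fo3+ (fo3+-∧₃ ψ-fo3+ (fo3+-translate φ))) (fo3+-globally₃ ψ-fo3+)
  where
  ψ-fo3+ : IsFO3+Unary (translate ψ)
  ψ-fo3+ = fo3+-translate ψ

module _ {n : ℕ} (u : Word n) where

  Until : (ℕ → Set) → (ℕ → Set) → ℕ → Set
  Until P Q i = Σ ℕ λ j → i ≤ j × j < length u × Q j × ((k : ℕ) → i ≤ k → k < j → P k)

  Globally : (ℕ → Set) → ℕ → Set
  Globally P i = (k : ℕ) → i ≤ k → k < length u → P k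

  record Expresses (F : Formula₃ n) (P : ℕ → Set) : Set where
    constructor expresses
    field
      sat⇔ : ∀ {x y z} → Distinct x y z → (ρ : Assign) {i : ℕ} → ρ x ≡ i → Sat u ρ (F x y z) ⇔ P i

  open Expresses

  until⇔guarded : ∀ {P Q : ℕ → Set} {i} →
    (Σ ℕ λ j → j < length u × (i ≤ j × (Q j × ((k : ℕ) → k < length u → k < i ⊎ (j ≤ k ⊎ P k)))))
    ⇔ Until P Q i
  until⇔guarded {P} {Q} {i} = mk⇔
    (λ (j , j<l , i≤j , q , g) → j , i≤j , j<l , q , to (guard⇔ j<l) g)
    (λ (j , i≤j , j<l , q , h) → j , j<l , i≤j , q , from (guard⇔ j<l) h)
    where
    guard⇔ : ∀ {j} → j < length u →
      ((k : ℕ) → k < length u → k < i ⊎ (j ≤ k ⊎ P k)) ⇔ ((k : ℕ) → i ≤ k → k < j → P k)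
    guard⇔ j<l = ⇔-trans lower-guard⇔ (upper-guard⇔ (<⇒≤ j<l))

  module _ {F G : Formula₃ n} {P Q : ℕ → Set} (F⇔P : Expresses F P) (G⇔Q : Expresses G Q) where

    expresses-∧₃ : Expresses (F ∧₃ G) (λ i → P i × Q i)
    expresses-∧₃ = expresses λ d ρ ρx≡i → sat⇔ F⇔P d ρ ρx≡i ×-⇔ sat⇔ G⇔Q d ρ ρx≡i

    expresses-∨₃ : Expresses (F ∨₃ G) (λ i → P i ⊎ Q i)
    expresses-∨₃ = expresses λ d ρ ρx≡i → sat⇔ F⇔P d ρ ρx≡i ⊎-⇔ sat⇔ G⇔Q d ρ ρx≡i

    expresses-until₃ : Expresses (until₃ F G) (Until P Q)
    expresses-until₃ = expresses λ d ρ ρx≡i → ⇔-trans (∃<-⇔ (body⇔ d ρ ρx≡i)) until⇔guarded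
      where
      body⇔ : ∀ {x y z} → Distinct x y z → (ρ : Assign) {i : ℕ} → ρ x ≡ i → ∀ j →
        Sat u (ρ [ y ↦ j ]) (rel le x y ∧ (G y x z ∧ all z (rel lt z x ∨ (rel le y z ∨ F z x y))))
        ⇔ (i ≤ j × (Q j × ((k : ℕ) → k < length u → k < i ⊎ (j ≤ k ⊎ P k))))
      body⇔ {x} {y} {z} d@(distinct y≢x z≢x z≢y) ρ {i} ρx≡i j =
        ⟦ le ⟧R-cong x↦i y↦j ×-⇔ (sat⇔ G⇔Q (swap d) ρ′ y↦j ×-⇔ ∀<-⇔ λ k →
          ⟦ lt ⟧R-cong (↦-same ρ′ z k) (↦-other k z≢x x↦i) ⊎-⇔
          (⟦ le ⟧R-cong (↦-other k z≢y y↦j) (↦-same ρ′ z k) ⊎-⇔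
           sat⇔ F⇔P (rotate d) (ρ′ [ z ↦ k ]) (↦-same ρ′ z k)))
        where
        ρ′ : Assign
        ρ′ = ρ [ y ↦ j ]
        x↦i : ρ′ x ≡ i
        x↦i = ↦-other j y≢x ρx≡i
        y↦j : ρ′ y ≡ j
        y↦j = ↦-same ρ y j

  module _ {F : Formula₃ n} {P : ℕ → Set} (F⇔P : Expresses F P) where

    expresses-next₃ : Expresses (next₃ F) (λ i → suc i < length u × P (suc i))
    expresses-next₃ = expresses λ {x} {y} d ρ ρx≡i →
      ⇔-trans (∃<-⇔ λ j →
                 ⟦ succ ⟧R-cong (↦-other j (Distinct.y≢x d) ρx≡i) (↦-same ρ y j) ×-⇔
                 sat⇔ F⇔P (swap d) (ρ [ y ↦ j ]) (↦-same ρ y j))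
              ∃<-one-point

    expresses-globally₃ : Expresses (globally₃ F) (Globally P)
    expresses-globally₃ = expresses λ {x} {y} d ρ ρx≡i →
      ⇔-trans (∀<-⇔ λ k →
                 ⟦ lt ⟧R-cong (↦-same ρ y k) (↦-other k (Distinct.y≢x d) ρx≡i) ⊎-⇔
                 sat⇔ F⇔P (swap d) (ρ [ y ↦ k ]) (↦-same ρ y k))
              lower-guard⇔

  expresses-translate : (φ : LTL+ n) → Expresses (translate φ) (λ i → SatL u i φ)
  expresses-translate ff = expresses λ _ _ _ → ⇔-refl
  expresses-translate tt = expresses λ _ _ _ → ⇔-refl
  expresses-translate (atom a) = expresses λ { _ _ refl → ⇔-refl }
  expresses-translate (φ ∧ ψ) = expresses-∧₃ (expresses-translate φ) (expresses-translate ψ)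
  expresses-translate (φ ∨ ψ) = expresses-∨₃ (expresses-translate φ) (expresses-translate ψ)
  expresses-translate (X φ) = expresses-next₃ (expresses-translate φ)
  expresses-translate (φ U ψ) = expresses-until₃ (expresses-translate φ) (expresses-translate ψ)
  expresses-translate (φ R ψ) =
    expresses-∨₃ (expresses-until₃ ψ⇔ (expresses-∧₃ ψ⇔ (expresses-translate φ))) (expresses-globally₃ ψ⇔)
    where
    ψ⇔ : Expresses (translate ψ) (λ i → SatL u i ψ)
    ψ⇔ = expresses-translate ψ

acceptsEmpty : ∀ {n} → LTL+ n → Bool
acceptsEmpty ff = false
acceptsEmpty tt = true
acceptsEmpty (atom _) = false
acceptsEmpty (φ ∧ ψ) = acceptsEmpty φ ∧ᵇ acceptsEmpty ψ
acceptsEmpty (φ ∨ ψ) = acceptsEmpty φ ∨ᵇ acceptsEmpty ψ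
acceptsEmpty (X _) = false
acceptsEmpty (_ U _) = false
acceptsEmpty (_ R _) = true

SatL-[]⇔acceptsEmpty : ∀ {n} (φ : LTL+ n) {i : ℕ} → SatL [] i φ ⇔ T (acceptsEmpty φ)
SatL-[]⇔acceptsEmpty ff = ⇔-refl
SatL-[]⇔acceptsEmpty tt = ⇔-refl
SatL-[]⇔acceptsEmpty (atom _) = mk⇔ (λ { (_ , () , _) }) λ ()
SatL-[]⇔acceptsEmpty (φ ∧ ψ) = ⇔-trans (SatL-[]⇔acceptsEmpty φ ×-⇔ SatL-[]⇔acceptsEmpty ψ) (⇔-sym T-∧)
SatL-[]⇔acceptsEmpty (φ ∨ ψ) = ⇔-trans (SatL-[]⇔acceptsEmpty φ ⊎-⇔ SatL-[]⇔acceptsEmpty ψ) (⇔-sym T-∨)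
SatL-[]⇔acceptsEmpty (X _) = mk⇔ (λ { (() , _) }) λ ()
SatL-[]⇔acceptsEmpty (_ U _) = mk⇔ (λ { (_ , _ , () , _) }) λ ()
SatL-[]⇔acceptsEmpty (_ R _) = mk⇔ _ λ _ → inj₂ λ _ _ ()

module _ {n : ℕ} where

  truth : Bool → FO n
  truth false = ff
  truth true = tt

  Sat-truth : (u : Word n) (ρ : Assign) (b : Bool) → Sat u ρ (truth b) ⇔ T b
  Sat-truth _ _ false = ⇔-refl
  Sat-truth _ _ true = ⇔-refl

  negFree-truth : (b : Bool) → NegFree (truth b)
  negFree-truth false = tt
  negFree-truth true = tt

  allVars-truth : (V : Var → Set) (b : Bool) → AllVars V (truth b)
  allVars-truth _ false = tt
  allVars-truth _ true = tt

  closed-truth : (b : Bool) → Closed (truth b)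
  closed-truth false _ ()
  closed-truth true _ ()

module _ {n : ℕ} where

  atFirst : Formula₃ n → FO n
  atFirst F = ex 0 (all 1 (rel le 0 1) ∧ F 0 1 2)

  isEmpty : FO n
  isEmpty = all 0 ff

  distinct-012 : Distinct 0 1 2
  distinct-012 = distinct (λ ()) (λ ()) (λ ())

  atFirst⇔ : ∀ {a w} {F : Formula₃ n} {P : ℕ → Set} → Expresses (a ∷ w) F P →
             (ρ : Assign) → Sat (a ∷ w) ρ (atFirst F) ⇔ P 0
  atFirst⇔ F⇔P ρ = mk⇔
    (λ (j , _ , first , s) → to (sat⇔ F⇔P distinct-012 (ρ [ 0 ↦ j ]) (n≤0⇒n≡0 (first 0 z<s))) s)
    (λ p → 0 , z<s , (λ _ _ → z≤n) , from (sat⇔ F⇔P distinct-012 (ρ [ 0 ↦ 0 ]) refl) p)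
    where open Expresses

closedTranslation : ∀ {n} → LTL+ n → FO n
closedTranslation φ = atFirst (translate φ) ∨ (isEmpty ∧ truth (acceptsEmpty φ))

FO3+-closedTranslation : ∀ {n} (φ : LTL+ n) → FO3+ (closedTranslation φ)
FO3+-closedTranslation φ =
  ((tt , negFree φ-fo3+ 0 1 2) , (tt , negFree-truth (acceptsEmpty φ))) ,
  0 , 1 , 2 ,
  ((v0 , (v1 , (v0 , v1)) , allVars φ-fo3+ V v0 v1 v2) , ((v0 , tt) , allVars-truth V (acceptsEmpty φ)))
  where
  φ-fo3+ : IsFO3+Unary (translate φ)
  φ-fo3+ = fo3+-translate φ
  V : Var → Set
  V v = v ≡ 0 ⊎ v ≡ 1 ⊎ v ≡ 2
  v0 : V 0
  v0 = inj₁ refl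
  v1 : V 1
  v1 = inj₂ (inj₁ refl)
  v2 : V 2
  v2 = inj₂ (inj₂ refl)

closed-closedTranslation : ∀ {n} (φ : LTL+ n) → Closed (closedTranslation φ)
closed-closedTranslation φ w (inj₁ (w≢0 , inj₁ (_ , inj₁ w≡0))) = w≢0 w≡0
closed-closedTranslation φ w (inj₁ (_ , inj₁ (w≢1 , inj₂ w≡1))) = w≢1 w≡1
closed-closedTranslation φ w (inj₁ (w≢0 , inj₂ p)) = w≢0 (freeOnlyFirst (fo3+-translate φ) p)
closed-closedTranslation φ w (inj₂ (inj₁ (_ , ())))
closed-closedTranslation φ w (inj₂ (inj₂ p)) = closed-truth (acceptsEmpty φ) w p

⊨-closedTranslation : ∀ {n} (φ : LTL+ n) (u : Word n) → (u ⊨L φ) ⇔ (u ⊨FO closedTranslation φ)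
⊨-closedTranslation φ [] = ⇔-trans (SatL-[]⇔acceptsEmpty φ) (mk⇔
  (λ t → inj₂ ((λ _ ()) , from (Sat-truth [] _ (acceptsEmpty φ)) t))
  λ { (inj₁ (_ , () , _)) ; (inj₂ (_ , t)) → to (Sat-truth [] _ (acceptsEmpty φ)) t })
⊨-closedTranslation φ u@(_ ∷ _) = ⇔-trans (⇔-sym (atFirst⇔ (expresses-translate u φ) _)) (mk⇔
  inj₁
  λ { (inj₁ s) → s ; (inj₂ (empty , _)) → ⊥-elim (empty 0 z<s) })

lemma21 : (n : ℕ) (φ : LTL+ n) →
    Σ (FO n) λ ψ → FO3+ ψ × Closed ψ × ((u : Word n) → (u ⊨L φ) ⇔ (u ⊨FO ψ))
lemma21 n φ =
  closedTranslation φ , FO3+-closedTranslation φ , closed-closedTranslation φ , ⊨-closedTranslation φ
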